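{- Let $r$ be a positive integer and let the derangement polynomials of order $r$, $d_{n}^{(r)}(x)$, be defined by $\frac{e^{xz}}{(1-z)^{r}}=\sum_{n\geq0}d_{n}^{(r)}(x)\frac{z^{n}}{n!}$. Then for every integer $n\ge0$, \[\det\left(d_{i+j-2}^{(r)}(z)\right)_{1\leq i,j\leq n+1}=r^{\overline{n}}\prod_{k=1}^{n}r^{\overline{k-1}}\,k!,\] where $r^{\overline{k}}=r(r+1)\cdots(r+k-1)$ and $r^{\overline{0}}=1$.
   Context: The generating function identity is an identity of formal power series in $z$; equivalently $d_{n}^{(r)}(x)=\sum_{k=0}^{n}\binom{n}{k}r^{\overline{k}}x^{n-k}$. -}

module Defs where

open import Level using (Level)
open import Data.Nat as ℕ using (ℕ; zero; suc; _∸_)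
open import Data.Nat.Combinatorics using (_C_)
open import Data.Fin using (Fin; zero; suc; toℕ; punchIn)
open import Algebra.Bundles using (CommutativeRing)

rise : ℕ → ℕ → ℕ
rise r zero    = 1
rise r (suc k) = rise r k ℕ.* (r ℕ.+ k)

prodRHS : ℕ → ℕ → ℕ
prodRHS r zero    = 1
prodRHS r (suc n) = prodRHS r n ℕ.* (rise r n ℕ.* (suc n) ℕ.!)

hankelRHS : ℕ → ℕ → ℕ
hankelRHS r n = rise r n ℕ.* prodRHS r n

module _ {c ℓ : Level} (R : CommutativeRing c ℓ) where
  open CommutativeRing R hiding (zero)

  fromℕ : ℕ → Carrier
  fromℕ zero    = 0#
  fromℕ (suc n) = 1# + fromℕ n

  pow : Carrier → ℕ → Carrier
  pow x zero    = 1#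
  pow x (suc n) = x * pow x n

  sumFin : (n : ℕ) → (Fin n → Carrier) → Carrier
  sumFin zero    f = 0#
  sumFin (suc n) f = f zero + sumFin n (λ i → f (suc i))

  sumTo : ℕ → (ℕ → Carrier) → Carrier
  sumTo zero    f = f zero
  sumTo (suc n) f = sumTo n f + f (suc n)

  sign : ℕ → Carrier
  sign zero    = 1#
  sign (suc k) = - sign k

  det : (n : ℕ) → (Fin n → Fin n → Carrier) → Carrier
  det zero    M = 1#
  det (suc n) M =
    sumFin (suc n) (λ j → sign (toℕ j) * (M zero j * det n (λ a b → M (suc a) (punchIn j b))))

  derangePoly : ℕ → ℕ → Carrier → Carrier
  derangePoly r n x = sumTo n (λ k → fromℕ ((n C k) ℕ.* rise r k) * pow x (n ∸ k))

  -- Hankel matrix (d_{i+j-2}^(r)(x))_{1≤i,j≤n+1}, 0-indexed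
  hankel : ℕ → (n : ℕ) → Carrier → Fin (suc n) → Fin (suc n) → Carrier
  hankel r n x i j = derangePoly r (toℕ i ℕ.+ toℕ j) x

-- Let E_a(b) be the coefficients of e^{xz} (d/dz)^a (1-z)^{-r} = Σ_b E_a(b) z^b / b!, so that
-- d_b^{(r)}(x) = E_0(b). Differentiation gives E_a(b+1) = x E_a(b) + E_{a+1}(b), so subtracting x times
-- column j-1 from column j, right to left and n times over, turns the Hankel matrix (E_0(i+j)) into
-- (E_j(i)) without changing its determinant. Next, (1-z) (d/dz)^{a+1} (1-z)^{-r} = (r+a) (d/dz)^a (1-z)^{-r}
-- gives E_{a+1}(i) = (r+a) E_a(i) + i E_{a+1}(i-1); subtracting (r+j-1) times column j-1 from column j
-- therefore leaves the first row (1, 0, ..., 0) above the block ((i+1) E_{j+1}(i)) = ((i+1) r E^{(r+1)}_j(i)).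
-- Hence det_{n+1} (E^{(r)}_j(i)) = n! r^n det_n (E^{(r+1)}_j(i)), and unfolding this recursion in n
-- yields the product.
module Submission where

open import Defs
open import Level using (Level)
open import Data.Nat using (ℕ; suc; _≤_)
open import Algebra.Bundles using (CommutativeRing)

open import Data.Nat as ℕ using (zero; _^_; _!; _∸_; _<_; _≤?_; _≟_; s≤s; z<s; s<s; s≤s⁻¹; s<s⁻¹)
import Data.Nat.Properties as ℕ
open import Data.Nat.Tactic.RingSolver using (solve-∀)
open import Data.Nat.Combinatorics using (_C_; nCk+nC[k+1]≡[n+1]C[k+1]; k>n⇒nCk≡0)
open import Data.Fin as Fin using (Fin; toℕ)
open import Data.Product using (∃-syntax; _×_; _,_)
open import Data.Sum using (_⊎_; inj₁; inj₂)
open import Data.Empty using (⊥-elim)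
open import Function using (_∘_)
open import Relation.Nullary using (yes; no; contradiction)
open import Relation.Binary.PropositionalEquality as ≡ using (_≡_; _≢_; module ≡-Reasoning)

punchIn : ℕ → ℕ → ℕ
punchIn zero    b       = suc b
punchIn (suc j) zero    = zero
punchIn (suc j) (suc b) = suc (punchIn j b)

punchOut : ℕ → ℕ → ℕ
punchOut zero    zero    = zero
punchOut zero    (suc l) = l
punchOut (suc j) zero    = zero
punchOut (suc j) (suc l) = suc (punchOut j l)

punchInᵢ≢i : ∀ j b → punchIn j b ≢ j
punchInᵢ≢i (suc j) (suc b) = punchInᵢ≢i j b ∘ ℕ.suc-injective

punchIn-injective : ∀ j a b → punchIn j a ≡ punchIn j b → a ≡ b
punchIn-injective zero    a       b       ≡.refl = ≡.refl
punchIn-injective (suc j) zero    zero    _    = ≡.refl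
punchIn-injective (suc j) (suc a) (suc b) eq   = ≡.cong suc (punchIn-injective j a b (ℕ.suc-injective eq))

punchIn-punchOut : ∀ {j l} → j ≢ l → punchIn j (punchOut j l) ≡ l
punchIn-punchOut {zero}  {zero}  0≢0 = ⊥-elim (0≢0 ≡.refl)
punchIn-punchOut {zero}  {suc l} _   = ≡.refl
punchIn-punchOut {suc j} {zero}  _   = ≡.refl
punchIn-punchOut {suc j} {suc l} j≢l = ≡.cong suc (punchIn-punchOut (j≢l ∘ ≡.cong suc))

punchIn-bounded : ∀ {n} j {b} → b < n → punchIn j b < suc n
punchIn-bounded zero    b<n             = s<s b<n
punchIn-bounded (suc j) {zero}  _       = z<s
punchIn-bounded (suc j) {suc b} (s<s b<n) = s<s (punchIn-bounded j b<n)

punchIn-bounded⁻¹ : ∀ {n} j b → j ≤ n → punchIn j b < suc n → b < n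
punchIn-bounded⁻¹ zero    b       _         p<    = s<s⁻¹ p<
punchIn-bounded⁻¹ (suc j) zero    (s≤s _)   _     = z<s
punchIn-bounded⁻¹ (suc j) (suc b) (s≤s j≤n) p<    = s<s (punchIn-bounded⁻¹ j b j≤n (s<s⁻¹ p<))

punchIn-adjacent : ∀ j l → j ≢ l → j ≢ suc l → ∃[ l′ ] punchIn j l′ ≡ l × punchIn j (suc l′) ≡ suc l
punchIn-adjacent zero          zero    0≢0 _   = ⊥-elim (0≢0 ≡.refl)
punchIn-adjacent zero          (suc l) _   _   = l , ≡.refl , ≡.refl
punchIn-adjacent (suc zero)    zero    _   1≢1 = ⊥-elim (1≢1 ≡.refl)
punchIn-adjacent (suc (suc j)) zero    _   _   = zero , ≡.refl , ≡.refl
punchIn-adjacent (suc j)       (suc l) j≢l j≢sl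
  with l′ , p , q ← punchIn-adjacent j l (j≢l ∘ ≡.cong suc) (j≢sl ∘ ≡.cong suc)
  = suc l′ , ≡.cong suc p , ≡.cong suc q

punchIn-swap : ∀ l b → punchIn l b ≡ punchIn (suc l) b ⊎ (punchIn l b ≡ suc l × punchIn (suc l) b ≡ l)
punchIn-swap zero    zero    = inj₂ (≡.refl , ≡.refl)
punchIn-swap zero    (suc b) = inj₁ ≡.refl
punchIn-swap (suc l) zero    = inj₁ ≡.refl
punchIn-swap (suc l) (suc b) with punchIn-swap l b
... | inj₁ eq         = inj₁ (≡.cong suc eq)
... | inj₂ (eq , eq′) = inj₂ (≡.cong suc eq , ≡.cong suc eq′)

toℕ-punchIn : ∀ {n} (j : Fin (suc n)) (b : Fin n) → toℕ (Fin.punchIn j b) ≡ punchIn (toℕ j) (toℕ b)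
toℕ-punchIn Fin.zero    b           = ≡.refl
toℕ-punchIn (Fin.suc j) Fin.zero    = ≡.refl
toℕ-punchIn (Fin.suc j) (Fin.suc b) = ≡.cong suc (toℕ-punchIn j b)

rise-suc : ∀ r k → rise r (suc k) ≡ r ℕ.* rise (suc r) k
rise-suc r zero    = ≡.trans (ℕ.*-identityˡ (r ℕ.+ 0)) (≡.trans (ℕ.+-identityʳ r) (≡.sym (ℕ.*-identityʳ r)))
rise-suc r (suc k) = begin
  rise r (suc k) ℕ.* (r ℕ.+ suc k)      ≡⟨ ≡.cong₂ ℕ._*_ (rise-suc r k) (ℕ.+-suc r k) ⟩
  r ℕ.* rise (suc r) k ℕ.* (suc r ℕ.+ k)  ≡⟨ ℕ.*-assoc r _ _ ⟩
  r ℕ.* rise (suc r) (suc k)          ∎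
  where open ≡-Reasoning

riseFactorial : ℕ → ℕ → ℕ
riseFactorial r zero    = 1
riseFactorial r (suc n) = riseFactorial r n ℕ.* (rise r (suc n) ℕ.* suc n !)

hankelRHS≡riseFactorial : ∀ r n → hankelRHS r n ≡ riseFactorial r n
hankelRHS≡riseFactorial r zero    = ≡.refl
hankelRHS≡riseFactorial r (suc n) = begin
  rise r (suc n) ℕ.* (prodRHS r n ℕ.* (rise r n ℕ.* suc n !))  ≡⟨ shuffle (rise r (suc n)) (prodRHS r n) (rise r n) (suc n !) ⟩
  rise r n ℕ.* prodRHS r n ℕ.* (rise r (suc n) ℕ.* suc n !)    ≡⟨ ≡.cong (ℕ._* (rise r (suc n) ℕ.* suc n !)) (hankelRHS≡riseFactorial r n) ⟩
  riseFactorial r (suc n)                               ∎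
  where
  open ≡-Reasoning
  shuffle : ∀ a b c d → a ℕ.* (b ℕ.* (c ℕ.* d)) ≡ c ℕ.* b ℕ.* (a ℕ.* d)
  shuffle = solve-∀

riseFactorial-suc : ∀ r n → riseFactorial r (suc n) ≡ suc n ! ℕ.* r ^ suc n ℕ.* riseFactorial (suc r) n
riseFactorial-suc r zero    = base r
  where
  base : ∀ r → 1 ℕ.* ((1 ℕ.* (r ℕ.+ 0)) ℕ.* 1) ≡ 1 ℕ.* (r ℕ.* 1) ℕ.* 1
  base = solve-∀
riseFactorial-suc r (suc n) = begin
  riseFactorial r (suc n) ℕ.* (rise r (suc (suc n)) ℕ.* suc (suc n) !)
    ≡⟨ ≡.cong₂ (λ p q → p ℕ.* (q ℕ.* suc (suc n) !)) (riseFactorial-suc r n) (rise-suc r (suc n)) ⟩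
  suc n ! ℕ.* r ^ suc n ℕ.* riseFactorial (suc r) n ℕ.* (r ℕ.* rise (suc r) (suc n) ℕ.* suc (suc n) !)
    ≡⟨ shuffle (suc n !) (r ^ suc n) (riseFactorial (suc r) n) r (rise (suc r) (suc n)) (suc (suc n)) ⟩
  suc (suc n) ! ℕ.* r ^ suc (suc n) ℕ.* riseFactorial (suc r) (suc n)
    ∎
  where
  open ≡-Reasoning
  shuffle : ∀ f p h r ρ m → f ℕ.* p ℕ.* h ℕ.* (r ℕ.* ρ ℕ.* (m ℕ.* f)) ≡ m ℕ.* f ℕ.* (r ℕ.* p) ℕ.* (h ℕ.* (ρ ℕ.* f))
  shuffle = solve-∀

module _ {c ℓ : Level} (R : CommutativeRing c ℓ) where
  open CommutativeRing R hiding (zero)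
  open import Relation.Binary.Reasoning.Setoid setoid
  open import Algebra.Solver.Ring.NaturalCoefficients.Default commutativeSemiring
  open import Algebra.Properties.Ring ring using (-‿distribˡ-*)
  import Algebra.Properties.Semiring.Mult semiring as Mult

  sum : ℕ → (ℕ → Carrier) → Carrier
  sum zero    f = 0#
  sum (suc n) f = f 0 + sum n (f ∘ suc)

  sum-cong : ∀ n {f g} → (∀ {j} → j < n → f j ≈ g j) → sum n f ≈ sum n g
  sum-cong zero    f≈g = refl
  sum-cong (suc n) f≈g = +-cong (f≈g z<s) (sum-cong n (f≈g ∘ s<s))

  sum-zero : ∀ n {f} → (∀ {j} → j < n → f j ≈ 0#) → sum n f ≈ 0#
  sum-zero zero    f≈0 = refl
  sum-zero (suc n) f≈0 = trans (+-cong (f≈0 z<s) (sum-zero n (f≈0 ∘ s<s))) (+-identityʳ 0#)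

  sum-+ : ∀ n f g → sum n (λ j → f j + g j) ≈ sum n f + sum n g
  sum-+ zero    f g = sym (+-identityʳ 0#)
  sum-+ (suc n) f g = begin
    (f 0 + g 0) + sum n (λ j → f (suc j) + g (suc j))      ≈⟨ +-congˡ (sum-+ n (f ∘ suc) (g ∘ suc)) ⟩
    (f 0 + g 0) + (sum n (f ∘ suc) + sum n (g ∘ suc))
      ≈⟨ solve 4 (λ a b c d → (a :+ b) :+ (c :+ d) := (a :+ c) :+ (b :+ d)) refl (f 0) (g 0) _ _ ⟩
    (f 0 + sum n (f ∘ suc)) + (g 0 + sum n (g ∘ suc))      ∎

  sum-*ˡ : ∀ n k f → sum n (λ j → k * f j) ≈ k * sum n f
  sum-*ˡ zero    k f = sym (zeroʳ k)
  sum-*ˡ (suc n) k f = trans (+-congˡ (sum-*ˡ n k (f ∘ suc))) (sym (distribˡ k (f 0) _))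

  sum-suc : ∀ n f → sum (suc n) f ≈ sum n f + f n
  sum-suc zero    f = +-comm (f 0) 0#
  sum-suc (suc n) f = trans (+-congˡ (sum-suc n (f ∘ suc))) (sym (+-assoc (f 0) _ _))

  sum-adjacent-cancel : ∀ n l {f} → suc l < n → (∀ {j} → j < n → j ≢ l → j ≢ suc l → f j ≈ 0#) →
                        f l + f (suc l) ≈ 0# → sum n f ≈ 0#
  sum-adjacent-cancel (suc (suc n)) zero    {f} _ rest≈0 pair≈0 = begin
    f 0 + (f 1 + sum n (f ∘ suc ∘ suc))  ≈⟨ +-congˡ (+-congˡ (sum-zero n λ j<n → rest≈0 (s<s (s<s j<n)) (λ ()) (λ ()))) ⟩
    f 0 + (f 1 + 0#)                     ≈⟨ +-congˡ (+-identityʳ (f 1)) ⟩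
    f 0 + f 1                            ≈⟨ pair≈0 ⟩
    0#                                   ∎
  sum-adjacent-cancel (suc n) (suc l) {f} (s<s sl<n) rest≈0 pair≈0 = begin
    f 0 + sum n (f ∘ suc)  ≈⟨ +-cong (rest≈0 z<s (λ ()) (λ ())) (sum-adjacent-cancel n l sl<n rest≈0′ pair≈0) ⟩
    0# + 0#                ≈⟨ +-identityʳ 0# ⟩
    0#                     ∎
    where
    rest≈0′ : ∀ {j} → j < n → j ≢ l → j ≢ suc l → f (suc j) ≈ 0#
    rest≈0′ j<n j≢l j≢sl = rest≈0 (s<s j<n) (j≢l ∘ ℕ.suc-injective) (j≢sl ∘ ℕ.suc-injective)

  prod : ℕ → (ℕ → Carrier) → Carrier
  prod zero    f = 1#
  prod (suc n) f = f 0 * prod n (f ∘ suc)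

  prod-suc : ∀ n f → prod (suc n) f ≈ prod n f * f n
  prod-suc zero    f = *-comm (f 0) 1#
  prod-suc (suc n) f = trans (*-congˡ (prod-suc n (f ∘ suc))) (sym (*-assoc (f 0) _ _))

  -- Matrices are indexed by ℕ so that column operations need no Fin casts; detℕ n M expands
  -- the leading n × n block along its first row exactly as det does.
  Matrix : Set c
  Matrix = ℕ → ℕ → Carrier

  minor : Matrix → ℕ → Matrix
  minor M j a b = M (suc a) (punchIn j b)

  detℕ : ℕ → Matrix → Carrier
  cofactorTerm : ℕ → Matrix → ℕ → Carrier

  detℕ zero    M = 1#
  detℕ (suc n) M = sum (suc n) (cofactorTerm n M)

  cofactorTerm n M j = sign R j * (M 0 j * detℕ n (minor M j))

  sumFin≈sum : ∀ n (f : Fin n → Carrier) g → (∀ j → f j ≈ g (toℕ j)) → sumFin R n f ≈ sum n g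
  sumFin≈sum zero    f g f≈g = refl
  sumFin≈sum (suc n) f g f≈g = +-cong (f≈g Fin.zero) (sumFin≈sum n (f ∘ Fin.suc) (g ∘ suc) (f≈g ∘ Fin.suc))

  det≈detℕ : ∀ n (M : Fin n → Fin n → Carrier) N → (∀ i j → M i j ≈ N (toℕ i) (toℕ j)) → det R n M ≈ detℕ n N
  det≈detℕ zero    M N M≈N = refl
  det≈detℕ (suc n) M N M≈N = sumFin≈sum (suc n) _ (cofactorTerm n N) λ j →
    *-congˡ {sign R (toℕ j)} (*-cong (M≈N Fin.zero j) (det≈detℕ n _ (minor N (toℕ j)) λ a b →
      trans (M≈N (Fin.suc a) (Fin.punchIn j b)) (reflexive (≡.cong (N (suc (toℕ a))) (toℕ-punchIn j b)))))

  detℕ-cong : ∀ n {M N} → (∀ {i j} → i < n → j < n → M i j ≈ N i j) → detℕ n M ≈ detℕ n N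
  detℕ-cong zero    M≈N = refl
  detℕ-cong (suc n) M≈N = sum-cong (suc n) λ {j} j<n →
    *-congˡ {sign R j} (*-cong (M≈N z<s j<n) (detℕ-cong n λ a<n b<n → M≈N (s<s a<n) (punchIn-bounded j b<n)))

  detℕ-linear : ∀ n l k (U V W : Matrix) → l < n →
                (∀ i → W i l ≈ k * V i l + U i l) →
                (∀ i q → q ≢ l → U i q ≈ W i q) → (∀ i q → q ≢ l → V i q ≈ W i q) →
                detℕ n W ≈ k * detℕ n V + detℕ n U
  detℕ-linear (suc n) l k U V W l<n W≈kV+U U≈W V≈W = begin
    sum (suc n) (term W)                              ≈⟨ sum-cong (suc n) (λ {j} j<n → expand j j<n) ⟩
    sum (suc n) (λ j → k * term V j + term U j)       ≈⟨ sum-+ (suc n) (λ j → k * term V j) (term U) ⟩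
    sum (suc n) (λ j → k * term V j) + detℕ (suc n) U ≈⟨ +-congʳ (sum-*ˡ (suc n) k (term V)) ⟩
    k * detℕ (suc n) V + detℕ (suc n) U               ∎
    where
    term : Matrix → ℕ → Carrier
    term = cofactorTerm n
    expand : ∀ j → j < suc n → term W j ≈ k * term V j + term U j
    expand j j<n with j ≟ l
    ... | yes ≡.refl = begin
      s * (W 0 j * dW)              ≈⟨ *-congˡ {s} (*-cong (W≈kV+U 0) (detℕ-cong n λ _ _ → sym (U≈W _ _ (punchInᵢ≢i j _)))) ⟩
      s * ((k * V 0 j + U 0 j) * dU)
        ≈⟨ solve 5 (λ s k v u d → s :* ((k :* v :+ u) :* d) := k :* (s :* (v :* d)) :+ s :* (u :* d)) refl s k (V 0 j) (U 0 j) dU ⟩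
      k * (s * (V 0 j * dU)) + s * (U 0 j * dU)
        ≈⟨ +-congʳ (*-congˡ {k} (*-congˡ {s} (*-congˡ {V 0 j} (detℕ-cong n λ _ _ → trans (U≈W _ _ (punchInᵢ≢i j _)) (sym (V≈W _ _ (punchInᵢ≢i j _))))))) ⟩
      k * term V j + term U j       ∎
      where
      s dW dU : Carrier
      s = sign R j
      dW = detℕ n (minor W j)
      dU = detℕ n (minor U j)
    ... | no j≢l = begin
      s * (W 0 j * dW)              ≈⟨ *-congˡ {s} (*-congˡ {W 0 j} minor-linear) ⟩
      s * (W 0 j * (k * dV + dU))
        ≈⟨ solve 5 (λ s k w a b → s :* (w :* (k :* a :+ b)) := k :* (s :* (w :* a)) :+ s :* (w :* b)) refl s k (W 0 j) dV dU ⟩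
      k * (s * (W 0 j * dV)) + s * (W 0 j * dU)
        ≈⟨ +-cong (*-congˡ {k} (*-congˡ {s} (*-congʳ (sym (V≈W 0 j j≢l))))) (*-congˡ {s} (*-congʳ (sym (U≈W 0 j j≢l)))) ⟩
      k * term V j + term U j       ∎
      where
      s dW dU dV : Carrier
      s = sign R j
      dW = detℕ n (minor W j)
      dU = detℕ n (minor U j)
      dV = detℕ n (minor V j)
      l′ : ℕ
      l′ = punchOut j l
      l′-in : punchIn j l′ ≡ l
      l′-in = punchIn-punchOut j≢l
      off-l : ∀ {q} → q ≢ l′ → punchIn j q ≢ l
      off-l q≢l′ eq = q≢l′ (punchIn-injective j _ l′ (≡.trans eq (≡.sym l′-in)))
      minor-linear : dW ≈ k * dV + dU
      minor-linear = detℕ-linear n l′ k (minor U j) (minor V j) (minor W j)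
        (punchIn-bounded⁻¹ j l′ (ℕ.s≤s⁻¹ j<n) (≡.subst (_< suc n) (≡.sym l′-in) l<n))
        (λ a → ≡.subst (λ q → W (suc a) q ≈ k * V (suc a) q + U (suc a) q) (≡.sym l′-in) (W≈kV+U (suc a)))
        (λ a q q≢l′ → U≈W (suc a) _ (off-l q≢l′))
        (λ a q q≢l′ → V≈W (suc a) _ (off-l q≢l′))

  detℕ-adjacent-columns : ∀ n l (M : Matrix) → suc l < n → (∀ i → M i l ≈ M i (suc l)) → detℕ n M ≈ 0#
  detℕ-adjacent-columns (suc zero)    l M (s<s ()) _
  detℕ-adjacent-columns (suc (suc n)) l M sl<n cols≈ =
    sum-adjacent-cancel (suc (suc n)) l sl<n
      (λ {j} j<n j≢l j≢sl →
        let l′ , in≡l , in≡sl = punchIn-adjacent j l j≢l j≢sl in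
        term-vanishes j (detℕ-adjacent-columns (suc n) l′ (minor M j)
          (punchIn-bounded⁻¹ j (suc l′) (ℕ.s≤s⁻¹ j<n) (≡.subst (_< suc (suc n)) (≡.sym in≡sl) sl<n))
          (λ a → ≡.subst₂ (λ p q → M (suc a) p ≈ M (suc a) q) (≡.sym in≡l) (≡.sym in≡sl) (cols≈ (suc a)))))
      cancel
    where
    term : ℕ → Carrier
    term = cofactorTerm (suc n) M
    term-vanishes : ∀ j → detℕ (suc n) (minor M j) ≈ 0# → term j ≈ 0#
    term-vanishes j minor≈0 = begin
      sign R j * (M 0 j * detℕ (suc n) (minor M j))  ≈⟨ *-congˡ {sign R j} (*-congˡ {M 0 j} minor≈0) ⟩
      sign R j * (M 0 j * 0#)                       ≈⟨ trans (*-congˡ {sign R j} (zeroʳ (M 0 j))) (zeroʳ (sign R j)) ⟩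
      0#                                            ∎
    minors≈ : ∀ a b → minor M l a b ≈ minor M (suc l) a b
    minors≈ a b with punchIn-swap l b
    ... | inj₁ eq         = reflexive (≡.cong (M (suc a)) eq)
    ... | inj₂ (eq , eq′) = ≡.subst₂ (λ p q → M (suc a) p ≈ M (suc a) q) (≡.sym eq) (≡.sym eq′) (sym (cols≈ (suc a)))
    cancel : term l + term (suc l) ≈ 0#
    cancel = begin
      s * (M 0 l * d) + - s * (M 0 (suc l) * d′)
        ≈⟨ +-congˡ (*-congˡ { - s} (*-cong (sym (cols≈ 0)) (detℕ-cong (suc n) λ {a} {b} _ _ → sym (minors≈ a b)))) ⟩
      s * (M 0 l * d) + - s * (M 0 l * d)         ≈⟨ +-congˡ (sym (-‿distribˡ-* s (M 0 l * d))) ⟩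
      s * (M 0 l * d) + - (s * (M 0 l * d))       ≈⟨ -‿inverseʳ _ ⟩
      0#                                          ∎
      where
      s d d′ : Carrier
      s = sign R l
      d = detℕ (suc n) (minor M l)
      d′ = detℕ (suc n) (minor M (suc l))

  copyColumn : ℕ → Matrix → Matrix
  copyColumn l M i q with q ≟ suc l
  ... | yes _ = M i l
  ... | no  _ = M i q

  copyColumn-≡ : ∀ l M i → copyColumn l M i (suc l) ≡ M i l
  copyColumn-≡ l M i with suc l ≟ suc l
  ... | yes _   = ≡.refl
  ... | no  l≢l = contradiction ≡.refl l≢l

  copyColumn-≢ : ∀ l M i {q} → q ≢ suc l → copyColumn l M i q ≡ M i q
  copyColumn-≢ l M i {q} q≢sl with q ≟ suc l
  ... | yes q≡sl = contradiction q≡sl q≢sl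
  ... | no  _    = ≡.refl

  detℕ-column-operation : ∀ n l k (M N : Matrix) →
                          (∀ i → M i (suc l) ≈ k * M i l + N i (suc l)) → (∀ i q → q ≢ suc l → N i q ≈ M i q) →
                          detℕ n N ≈ detℕ n M
  detℕ-column-operation n l k M N M≈kM+N N≈M with suc l ℕ.<? n
  ... | no  sl≮n = detℕ-cong n λ {i} {q} _ q<n → N≈M i q λ q≡sl → sl≮n (≡.subst (_< n) q≡sl q<n)
  ... | yes sl<n = sym (begin
    detℕ n M                   ≈⟨ detℕ-linear n (suc l) k N V M sl<n M≈kV+N N≈M V≈M ⟩
    k * detℕ n V + detℕ n N    ≈⟨ +-congʳ (*-congˡ {k} (detℕ-adjacent-columns n l V sl<n V-adjacent)) ⟩
    k * 0# + detℕ n N          ≈⟨ trans (+-congʳ (zeroʳ k)) (+-identityˡ _) ⟩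
    detℕ n N                   ∎)
    where
    V : Matrix
    V = copyColumn l N
    l≢sl : l ≢ suc l
    l≢sl = ℕ.<⇒≢ (ℕ.n<1+n l)
    M≈kV+N : ∀ i → M i (suc l) ≈ k * V i (suc l) + N i (suc l)
    M≈kV+N i = trans (M≈kM+N i) (+-congʳ (*-congˡ {k} (trans (sym (N≈M i l l≢sl)) (reflexive (≡.sym (copyColumn-≡ l N i))))))
    V≈M : ∀ i q → q ≢ suc l → V i q ≈ M i q
    V≈M i q q≢sl = trans (reflexive (copyColumn-≢ l N i q≢sl)) (N≈M i q q≢sl)
    V-adjacent : ∀ i → V i l ≈ V i (suc l)
    V-adjacent i = reflexive (≡.trans (copyColumn-≢ l N i l≢sl) (≡.sym (copyColumn-≡ l N i)))

  splice : ℕ → Matrix → Matrix → Matrix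
  splice k M N i j with j ≤? k
  ... | yes _ = M i j
  ... | no  _ = N i j

  splice-≤ : ∀ k M N i {j} → j ≤ k → splice k M N i j ≡ M i j
  splice-≤ k M N i {j} j≤k with j ≤? k
  ... | yes _   = ≡.refl
  ... | no  j≰k = contradiction j≤k j≰k

  splice-> : ∀ k M N i {j} → k < j → splice k M N i j ≡ N i j
  splice-> k M N i {j} k<j with j ≤? k
  ... | yes j≤k = contradiction j≤k (ℕ.<⇒≱ k<j)
  ... | no  _   = ≡.refl

  detℕ-column-sweep : ∀ n s (c : ℕ → Carrier) (M N : Matrix) →
                      (∀ i j → j ≤ s → N i j ≈ M i j) →
                      (∀ i t → M i (suc (s ℕ.+ t)) ≈ c t * M i (s ℕ.+ t) + N i (suc (s ℕ.+ t))) →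
                      detℕ n N ≈ detℕ n M
  detℕ-column-sweep n s c M N N≈M M≈cM+N = begin
    detℕ n N        ≈⟨ detℕ-cong n (λ {i} {j} _ _ → N≈T₀ i j) ⟩
    detℕ n (T 0)    ≈⟨ T₀≈T n ⟩
    detℕ n (T n)    ≈⟨ detℕ-cong n (λ {i} {j} _ j<n → reflexive (splice-≤ (s ℕ.+ n) M N i (ℕ.≤-trans (ℕ.<⇒≤ j<n) (ℕ.m≤n+m n s)))) ⟩
    detℕ n M        ∎
    where
    T : ℕ → Matrix
    T t = splice (s ℕ.+ t) M N
    N≈T₀ : ∀ i j → N i j ≈ T 0 i j
    N≈T₀ i j with ℕ.≤-<-connex j (s ℕ.+ 0)
    ... | inj₁ j≤s = trans (N≈M i j (≡.subst (j ≤_) (ℕ.+-identityʳ s) j≤s)) (reflexive (≡.sym (splice-≤ _ M N i j≤s)))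
    ... | inj₂ s<j = reflexive (≡.sym (splice-> _ M N i s<j))
    T-step : ∀ t → detℕ n (T t) ≈ detℕ n (T (suc t))
    T-step t = detℕ-column-operation n (s ℕ.+ t) (c t) (T (suc t)) (T t) column others
      where
      sst≡s+st : suc (s ℕ.+ t) ≡ s ℕ.+ suc t
      sst≡s+st = ≡.sym (ℕ.+-suc s t)
      st≤s+st : s ℕ.+ t ≤ s ℕ.+ suc t
      st≤s+st = ℕ.+-monoʳ-≤ s (ℕ.n≤1+n t)
      column : ∀ i → T (suc t) i (suc (s ℕ.+ t)) ≈ c t * T (suc t) i (s ℕ.+ t) + T t i (suc (s ℕ.+ t))
      column i = ≡.subst₂ (λ p q → p ≈ c t * q + T t i (suc (s ℕ.+ t)))
        (≡.sym (splice-≤ (s ℕ.+ suc t) M N i (ℕ.≤-reflexive sst≡s+st)))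
        (≡.sym (splice-≤ (s ℕ.+ suc t) M N i st≤s+st))
        (≡.subst (λ p → M i (suc (s ℕ.+ t)) ≈ c t * M i (s ℕ.+ t) + p)
          (≡.sym (splice-> (s ℕ.+ t) M N i ℕ.≤-refl)) (M≈cM+N i t))
      others : ∀ i q → q ≢ suc (s ℕ.+ t) → T t i q ≈ T (suc t) i q
      others i q q≢sst with ℕ.≤-<-connex q (s ℕ.+ t)
      ... | inj₁ q≤st = reflexive (≡.trans (splice-≤ _ M N i q≤st) (≡.sym (splice-≤ _ M N i (ℕ.≤-trans q≤st st≤s+st))))
      ... | inj₂ st<q = reflexive (≡.trans (splice-> _ M N i st<q) (≡.sym (splice-> _ M N i (≡.subst (_< q) sst≡s+st (ℕ.≤∧≢⇒< st<q (q≢sst ∘ ≡.sym))))))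
    T₀≈T : ∀ t → detℕ n (T 0) ≈ detℕ n (T t)
    T₀≈T zero    = refl
    T₀≈T (suc t) = trans (T₀≈T t) (T-step t)

  detℕ-first-row-unit : ∀ n (M : Matrix) → M 0 0 ≈ 1# → (∀ t → M 0 (suc t) ≈ 0#) →
                        detℕ (suc n) M ≈ detℕ n (minor M 0)
  detℕ-first-row-unit n M M₀₀≈1 M₀ₜ≈0 = begin
    1# * (M 0 0 * d) + sum n (λ j → sign R (suc j) * (M 0 (suc j) * detℕ n (minor M (suc j))))
      ≈⟨ +-cong (*-identityˡ _) (sum-zero n λ {j} _ → trans (*-congˡ {sign R (suc j)} (trans (*-congʳ (M₀ₜ≈0 j)) (zeroˡ _))) (zeroʳ _)) ⟩
    M 0 0 * d + 0#  ≈⟨ trans (+-identityʳ _) (*-congʳ M₀₀≈1) ⟩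
    1# * d          ≈⟨ *-identityˡ d ⟩
    d               ∎
    where
    d : Carrier
    d = detℕ n (minor M 0)

  detℕ-scale-rows : ∀ n (f : ℕ → Carrier) (M : Matrix) → detℕ n (λ a b → f a * M a b) ≈ prod n f * detℕ n M
  detℕ-scale-rows zero    f M = sym (*-identityʳ 1#)
  detℕ-scale-rows (suc n) f M = begin
    sum (suc n) (λ j → sign R j * ((f 0 * M 0 j) * detℕ n (λ a b → f (suc a) * minor M j a b)))
      ≈⟨ sum-cong (suc n) (λ {j} _ → *-congˡ {sign R j} (*-congˡ {f 0 * M 0 j} (detℕ-scale-rows n (f ∘ suc) (minor M j)))) ⟩
    sum (suc n) (λ j → sign R j * ((f 0 * M 0 j) * (prod n (f ∘ suc) * detℕ n (minor M j))))
      ≈⟨ sum-cong (suc n) (λ {j} _ → solve 5 (λ s a m p d → s :* ((a :* m) :* (p :* d)) := (a :* p) :* (s :* (m :* d))) refl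
           (sign R j) (f 0) (M 0 j) (prod n (f ∘ suc)) (detℕ n (minor M j))) ⟩
    sum (suc n) (λ j → prod (suc n) f * (sign R j * (M 0 j * detℕ n (minor M j))))
      ≈⟨ sum-*ˡ (suc n) (prod (suc n) f) (cofactorTerm n M) ⟩
    prod (suc n) f * detℕ (suc n) M ∎

  fromℕ≡×1# : ∀ n → fromℕ R n ≡ n Mult.× 1#
  fromℕ≡×1# zero    = ≡.refl
  fromℕ≡×1# (suc n) = ≡.cong (1# +_) (fromℕ≡×1# n)

  fromℕ-+ : ∀ m n → fromℕ R (m ℕ.+ n) ≈ fromℕ R m + fromℕ R n
  fromℕ-+ m n rewrite fromℕ≡×1# (m ℕ.+ n) | fromℕ≡×1# m | fromℕ≡×1# n = Mult.×-homo-+ 1# m n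

  fromℕ-* : ∀ m n → fromℕ R (m ℕ.* n) ≈ fromℕ R m * fromℕ R n
  fromℕ-* m n rewrite fromℕ≡×1# (m ℕ.* n) | fromℕ≡×1# m | fromℕ≡×1# n = Mult.×1-homo-* m n

  sumTo≈sum : ∀ n f → sumTo R n f ≈ sum (suc n) f
  sumTo≈sum zero    f = sym (+-identityʳ (f 0))
  sumTo≈sum (suc n) f = trans (+-congʳ (sumTo≈sum n f)) (sym (sum-suc (suc n) f))

  -- If f has exponential generating function F(z), then timesZ f has z F(z).
  timesZ : (ℕ → Carrier) → ℕ → Carrier
  timesZ f zero    = 0#
  timesZ f (suc i) = fromℕ R (suc i) * f i

  timesZ-linear : ∀ x f g i → x * timesZ f i + timesZ g i ≈ timesZ (λ j → x * f j + g j) i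
  timesZ-linear x f g zero    = trans (+-identityʳ _) (zeroʳ x)
  timesZ-linear x f g (suc i) = solve 4 (λ x n a b → x :* (n :* a) :+ n :* b := n :* (x :* a :+ b)) refl x (fromℕ R (suc i)) (f i) (g i)

  timesZ-leibniz : ∀ f i → f i + timesZ (f ∘ suc) i ≈ timesZ f (suc i)
  timesZ-leibniz f zero    = solve 1 (λ a → a :+ con 0 := (con 1 :+ con 0) :* a) refl (f 0)
  timesZ-leibniz f (suc i) = solve 2 (λ n a → a :+ n :* a := (con 1 :+ n) :* a) refl (fromℕ R (suc i)) (f (suc i))

  module _ (x : Carrier) where

    binomialSum : ℕ → (ℕ → Carrier) → Carrier
    binomialSum n g = sum (suc n) (λ k → fromℕ R (n C k) * g k * pow R x (n ∸ k))

    binomialSum-cong : ∀ n {g h} → (∀ k → g k ≈ h k) → binomialSum n g ≈ binomialSum n h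
    binomialSum-cong n g≈h = sum-cong (suc n) λ {k} _ → *-congʳ {pow R x (n ∸ k)} (*-congˡ {fromℕ R (n C k)} (g≈h k))

    binomialSum-suc : ∀ n g → binomialSum (suc n) g ≈ x * binomialSum n g + binomialSum n (g ∘ suc)
    binomialSum-suc n g = begin
      g₀ + sum (suc n) (λ k → fromℕ R (suc n C suc k) * g (suc k) * pow R x (n ∸ k))
        ≈⟨ +-congˡ (sum-cong (suc n) λ {k} _ → pascal k) ⟩
      g₀ + sum (suc n) (λ k → fromℕ R (n C k) * g (suc k) * pow R x (n ∸ k) + upper k)
        ≈⟨ +-congˡ (sum-+ (suc n) (λ k → fromℕ R (n C k) * g (suc k) * pow R x (n ∸ k)) upper) ⟩
      g₀ + (binomialSum n (g ∘ suc) + sum (suc n) upper)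
        ≈⟨ +-congˡ (+-congˡ upper-sum) ⟩
      g₀ + (binomialSum n (g ∘ suc) + x * sum n lower)
        ≈⟨ solve 6 (λ x a b c s t → a :* b :* (x :* c) :+ (s :+ x :* t) := x :* (a :* b :* c :+ t) :+ s) refl
             x (fromℕ R 1) (g 0) (pow R x n) (binomialSum n (g ∘ suc)) (sum n lower) ⟩
      x * binomialSum n g + binomialSum n (g ∘ suc) ∎
      where
      g₀ : Carrier
      g₀ = fromℕ R 1 * g 0 * (x * pow R x n)
      upper lower : ℕ → Carrier
      upper k = fromℕ R (n C suc k) * g (suc k) * pow R x (n ∸ k)
      lower k = fromℕ R (n C suc k) * g (suc k) * pow R x (n ∸ suc k)
      pascal : ∀ k → fromℕ R (suc n C suc k) * g (suc k) * pow R x (n ∸ k) ≈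
                     fromℕ R (n C k) * g (suc k) * pow R x (n ∸ k) + upper k
      pascal k = begin
        fromℕ R (suc n C suc k) * g (suc k) * pow R x (n ∸ k)
          ≡⟨ ≡.cong (λ m → fromℕ R m * g (suc k) * pow R x (n ∸ k)) (≡.sym (nCk+nC[k+1]≡[n+1]C[k+1] n k)) ⟩
        fromℕ R (n C k ℕ.+ n C suc k) * g (suc k) * pow R x (n ∸ k) ≈⟨ *-congʳ (*-congʳ (fromℕ-+ (n C k) (n C suc k))) ⟩
        (fromℕ R (n C k) + fromℕ R (n C suc k)) * g (suc k) * pow R x (n ∸ k)
          ≈⟨ trans (*-congʳ (distribʳ (g (suc k)) _ _)) (distribʳ _ _ _) ⟩
        fromℕ R (n C k) * g (suc k) * pow R x (n ∸ k) + upper k ∎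
      upper-sum : sum (suc n) upper ≈ x * sum n lower
      upper-sum = begin
        sum (suc n) upper                   ≈⟨ sum-suc n upper ⟩
        sum n upper + upper n               ≈⟨ +-cong (sum-cong n λ {k} k<n → upper≈x*lower k<n) top≈0 ⟩
        sum n (λ k → x * lower k) + 0#      ≈⟨ trans (+-identityʳ _) (sum-*ˡ n x lower) ⟩
        x * sum n lower                     ∎
        where
        upper≈x*lower : ∀ {k} → k < n → upper k ≈ x * lower k
        upper≈x*lower {k} k<n = begin
          fromℕ R (n C suc k) * g (suc k) * pow R x (n ∸ k)
            ≡⟨ ≡.cong (λ m → fromℕ R (n C suc k) * g (suc k) * pow R x m) (ℕ.+-∸-assoc 1 k<n) ⟩
          fromℕ R (n C suc k) * g (suc k) * (x * pow R x (n ∸ suc k))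
            ≈⟨ solve 3 (λ x a p → a :* (x :* p) := x :* (a :* p)) refl x (fromℕ R (n C suc k) * g (suc k)) (pow R x (n ∸ suc k)) ⟩
          x * lower k                                                  ∎
        top≈0 : upper n ≈ 0#
        top≈0 = begin
          fromℕ R (n C suc n) * g (suc n) * pow R x (n ∸ n)
            ≡⟨ ≡.cong (λ m → fromℕ R m * g (suc n) * pow R x (n ∸ n)) (k>n⇒nCk≡0 (ℕ.n<1+n n)) ⟩
          0# * g (suc n) * pow R x (n ∸ n)                    ≈⟨ trans (*-congʳ (zeroˡ _)) (zeroˡ _) ⟩
          0#                                                 ∎

    -- E r a b is E_a(b) above, for the order r.
    E : ℕ → ℕ → ℕ → Carrier
    E r a zero    = fromℕ R (rise r a)
    E r a (suc b) = x * E r a b + E r (suc a) b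

    E≈binomialSum : ∀ r a n → E r a n ≈ binomialSum n (λ k → fromℕ R (rise r (a ℕ.+ k)))
    E≈binomialSum r a zero    = begin
      fromℕ R (rise r a)                                  ≡⟨ ≡.cong (fromℕ R ∘ rise r) (≡.sym (ℕ.+-identityʳ a)) ⟩
      fromℕ R (rise r (a ℕ.+ 0))                          ≈⟨ solve 1 (λ e → e := (con 1 :+ con 0) :* e :* con 1 :+ con 0) refl _ ⟩
      binomialSum 0 (λ k → fromℕ R (rise r (a ℕ.+ k)))    ∎
    E≈binomialSum r a (suc n) = begin
      x * E r a n + E r (suc a) n
        ≈⟨ +-cong (*-congˡ (E≈binomialSum r a n)) (E≈binomialSum r (suc a) n) ⟩
      x * binomialSum n g + binomialSum n (λ k → fromℕ R (rise r (suc a ℕ.+ k)))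
        ≈⟨ +-congˡ (binomialSum-cong n λ k → reflexive (≡.cong (fromℕ R ∘ rise r) (≡.sym (ℕ.+-suc a k)))) ⟩
      x * binomialSum n g + binomialSum n (g ∘ suc)
        ≈⟨ binomialSum-suc n g ⟨
      binomialSum (suc n) g ∎
      where
      g : ℕ → Carrier
      g k = fromℕ R (rise r (a ℕ.+ k))

    derangePoly≈E : ∀ r n → derangePoly R r n x ≈ E r 0 n
    derangePoly≈E r n = begin
      derangePoly R r n x                                                      ≈⟨ sumTo≈sum n _ ⟩
      sum (suc n) (λ k → fromℕ R ((n C k) ℕ.* rise r k) * pow R x (n ∸ k))
        ≈⟨ sum-cong (suc n) (λ {k} _ → *-congʳ {pow R x (n ∸ k)} (fromℕ-* (n C k) (rise r k))) ⟩
      binomialSum n (λ k → fromℕ R (rise r k))                                 ≈⟨ E≈binomialSum r 0 n ⟨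
      E r 0 n                                                                  ∎

    E-order-suc : ∀ r a i → E r (suc a) i ≈ fromℕ R (r ℕ.+ a) * E r a i + timesZ (E r (suc a)) i
    E-order-suc r a zero    = begin
      fromℕ R (rise r a ℕ.* (r ℕ.+ a))                ≈⟨ fromℕ-* (rise r a) (r ℕ.+ a) ⟩
      fromℕ R (rise r a) * fromℕ R (r ℕ.+ a)          ≈⟨ solve 2 (λ e p → e :* p := p :* e :+ con 0) refl _ _ ⟩
      fromℕ R (r ℕ.+ a) * fromℕ R (rise r a) + 0#     ∎
    E-order-suc r a (suc i) = begin
      x * B + E r (suc (suc a)) i
        ≈⟨ +-cong (*-congˡ (E-order-suc r a i)) (E-order-suc r (suc a) i) ⟩
      x * (p * A + Z₁) + (fromℕ R (r ℕ.+ suc a) * B + Z₂)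
        ≡⟨ ≡.cong (λ m → x * (p * A + Z₁) + (fromℕ R m * B + Z₂)) (ℕ.+-suc r a) ⟩
      x * (p * A + Z₁) + ((1# + p) * B + Z₂)
        ≈⟨ solve 6 (λ x p a b z₁ z₂ → x :* (p :* a :+ z₁) :+ ((con 1 :+ p) :* b :+ z₂) := p :* (x :* a :+ b) :+ (b :+ (x :* z₁ :+ z₂))) refl x p A B Z₁ Z₂ ⟩
      p * E r a (suc i) + (B + (x * Z₁ + Z₂))
        ≈⟨ +-congˡ (+-congˡ (timesZ-linear x (E r (suc a)) (E r (suc (suc a))) i)) ⟩
      p * E r a (suc i) + (B + timesZ (E r (suc a) ∘ suc) i)
        ≈⟨ +-congˡ (timesZ-leibniz (E r (suc a)) i) ⟩
      p * E r a (suc i) + timesZ (E r (suc a)) (suc i) ∎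
      where
      p A B Z₁ Z₂ : Carrier
      p = fromℕ R (r ℕ.+ a)
      A = E r a i
      B = E r (suc a) i
      Z₁ = timesZ (E r (suc a)) i
      Z₂ = timesZ (E r (suc (suc a))) i

    E-rise-suc : ∀ r a i → E r (suc a) i ≈ fromℕ R r * E (suc r) a i
    E-rise-suc r a zero    = trans (reflexive (≡.cong (fromℕ R) (rise-suc r a))) (fromℕ-* r (rise (suc r) a))
    E-rise-suc r a (suc i) = begin
      x * E r (suc a) i + E r (suc (suc a)) i                   ≈⟨ +-cong (*-congˡ (E-rise-suc r a i)) (E-rise-suc r (suc a) i) ⟩
      x * (fromℕ R r * E (suc r) a i) + fromℕ R r * E (suc r) (suc a) i
        ≈⟨ solve 4 (λ x q u v → x :* (q :* u) :+ q :* v := q :* (x :* u :+ v)) refl x (fromℕ R r) (E (suc r) a i) (E (suc r) (suc a) i) ⟩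
      fromℕ R r * E (suc r) a (suc i)                           ∎

    orderMatrix : ℕ → Matrix
    orderMatrix r i j = E r j i

    partiallyReduced : ℕ → ℕ → Matrix
    partiallyReduced r s i j = E r (j ℕ.⊓ s) (i ℕ.+ (j ∸ s))

    partiallyReduced-≤ : ∀ r s i {j} → j ≤ s → partiallyReduced r s i j ≡ E r j i
    partiallyReduced-≤ r s i j≤s = ≡.cong₂ (E r) (ℕ.m≤n⇒m⊓n≡m j≤s) (≡.trans (≡.cong (i ℕ.+_) (ℕ.m≤n⇒m∸n≡0 j≤s)) (ℕ.+-identityʳ i))

    partiallyReduced-+ : ∀ r s i t → partiallyReduced r s i (s ℕ.+ t) ≡ E r s (i ℕ.+ t)
    partiallyReduced-+ r s i t = ≡.cong₂ (E r) (ℕ.m≥n⇒m⊓n≡n (ℕ.m≤m+n s t)) (≡.cong (i ℕ.+_) (ℕ.m+n∸m≡n s t))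

    detℕ-partiallyReduced-suc : ∀ r m s → detℕ m (partiallyReduced r (suc s)) ≈ detℕ m (partiallyReduced r s)
    detℕ-partiallyReduced-suc r m s = detℕ-column-sweep m s (λ _ → x) (partiallyReduced r s) (partiallyReduced r (suc s))
      (λ i j j≤s → reflexive (≡.trans (partiallyReduced-≤ r (suc s) i (ℕ.m≤n⇒m≤1+n j≤s)) (≡.sym (partiallyReduced-≤ r s i j≤s))))
      λ i t → begin
        partiallyReduced r s i (suc (s ℕ.+ t))        ≡⟨ ≡.cong (partiallyReduced r s i) (≡.sym (ℕ.+-suc s t)) ⟩
        partiallyReduced r s i (s ℕ.+ suc t)          ≡⟨ partiallyReduced-+ r s i (suc t) ⟩
        E r s (i ℕ.+ suc t)                           ≡⟨ ≡.cong (E r s) (ℕ.+-suc i t) ⟩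
        x * E r s (i ℕ.+ t) + E r (suc s) (i ℕ.+ t)
          ≡⟨ ≡.cong₂ (λ p q → x * p + q) (≡.sym (partiallyReduced-+ r s i t)) (≡.sym (partiallyReduced-+ r (suc s) i t)) ⟩
        x * partiallyReduced r s i (s ℕ.+ t) + partiallyReduced r (suc s) i (suc (s ℕ.+ t)) ∎

    detℕ-hankel≈orderMatrix : ∀ r n → detℕ (suc n) (λ i j → E r 0 (i ℕ.+ j)) ≈ detℕ (suc n) (orderMatrix r)
    detℕ-hankel≈orderMatrix r n = begin
      detℕ (suc n) (λ i j → E r 0 (i ℕ.+ j))
        ≈⟨ detℕ-cong (suc n) (λ {i} {j} _ _ → reflexive (≡.cong (λ k → E r k (i ℕ.+ j)) (≡.sym (ℕ.⊓-zeroʳ j)))) ⟩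
      detℕ (suc n) (partiallyReduced r 0)        ≈⟨ iterate n ⟨
      detℕ (suc n) (partiallyReduced r n)        ≈⟨ detℕ-cong (suc n) (λ {i} _ j<n → reflexive (partiallyReduced-≤ r n i (ℕ.s≤s⁻¹ j<n))) ⟩
      detℕ (suc n) (orderMatrix r)               ∎
      where
      iterate : ∀ s → detℕ (suc n) (partiallyReduced r s) ≈ detℕ (suc n) (partiallyReduced r 0)
      iterate zero    = refl
      iterate (suc s) = trans (detℕ-partiallyReduced-suc r (suc n) s) (iterate s)

    reducedOrderMatrix : ℕ → Matrix
    reducedOrderMatrix r i zero    = E r 0 i
    reducedOrderMatrix r i (suc t) = timesZ (E r (suc t)) i

    detℕ-orderMatrix-suc : ∀ r n → detℕ (suc (suc n)) (orderMatrix r) ≈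
                           prod (suc n) (λ a → fromℕ R (suc a) * fromℕ R r) * detℕ (suc n) (orderMatrix (suc r))
    detℕ-orderMatrix-suc r n = begin
      detℕ (suc (suc n)) (orderMatrix r)
        ≈⟨ detℕ-column-sweep (suc (suc n)) 0 (λ t → fromℕ R (r ℕ.+ t)) (orderMatrix r) (reducedOrderMatrix r)
             (λ { i zero _ → refl }) (λ i t → E-order-suc r t i) ⟨
      detℕ (suc (suc n)) (reducedOrderMatrix r)
        ≈⟨ detℕ-first-row-unit (suc n) (reducedOrderMatrix r) (+-identityʳ 1#) (λ _ → refl) ⟩
      detℕ (suc n) (λ a b → fromℕ R (suc a) * E r (suc b) a)
        ≈⟨ detℕ-cong (suc n) (λ {a} {b} _ _ → trans (*-congˡ {fromℕ R (suc a)} (E-rise-suc r b a)) (sym (*-assoc _ _ _))) ⟩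
      detℕ (suc n) (λ a b → (fromℕ R (suc a) * fromℕ R r) * orderMatrix (suc r) a b)
        ≈⟨ detℕ-scale-rows (suc n) (λ a → fromℕ R (suc a) * fromℕ R r) (orderMatrix (suc r)) ⟩
      prod (suc n) (λ a → fromℕ R (suc a) * fromℕ R r) * detℕ (suc n) (orderMatrix (suc r)) ∎

    prod-factorial : ∀ n r → prod n (λ a → fromℕ R (suc a) * fromℕ R r) ≈ fromℕ R (n ! ℕ.* r ^ n)
    prod-factorial zero    r = sym (+-identityʳ 1#)
    prod-factorial (suc n) r = begin
      prod (suc n) (λ a → fromℕ R (suc a) * fromℕ R r)                  ≈⟨ prod-suc n _ ⟩
      prod n (λ a → fromℕ R (suc a) * fromℕ R r) * (fromℕ R (suc n) * fromℕ R r)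
        ≈⟨ *-congʳ (trans (prod-factorial n r) (fromℕ-* (n !) (r ^ n))) ⟩
      (fromℕ R (n !) * fromℕ R (r ^ n)) * (fromℕ R (suc n) * fromℕ R r)
        ≈⟨ solve 4 (λ a b c d → (a :* b) :* (c :* d) := (c :* a) :* (d :* b)) refl _ _ _ _ ⟩
      (fromℕ R (suc n) * fromℕ R (n !)) * (fromℕ R r * fromℕ R (r ^ n))
        ≈⟨ *-cong (fromℕ-* (suc n) (n !)) (fromℕ-* r (r ^ n)) ⟨
      fromℕ R (suc n !) * fromℕ R (r ^ suc n)                           ≈⟨ fromℕ-* (suc n !) (r ^ suc n) ⟨
      fromℕ R (suc n ! ℕ.* r ^ suc n)                                   ∎

    detℕ-orderMatrix : ∀ r n → detℕ (suc n) (orderMatrix r) ≈ fromℕ R (riseFactorial r n)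
    detℕ-orderMatrix r zero    = solve 1 (λ e → con 1 :* (e :* con 1) :+ con 0 := e) refl (fromℕ R 1)
    detℕ-orderMatrix r (suc n) = begin
      detℕ (suc (suc n)) (orderMatrix r)
        ≈⟨ detℕ-orderMatrix-suc r n ⟩
      prod (suc n) (λ a → fromℕ R (suc a) * fromℕ R r) * detℕ (suc n) (orderMatrix (suc r))
        ≈⟨ *-cong (prod-factorial (suc n) r) (detℕ-orderMatrix (suc r) n) ⟩
      fromℕ R (suc n ! ℕ.* r ^ suc n) * fromℕ R (riseFactorial (suc r) n)
        ≈⟨ fromℕ-* (suc n ! ℕ.* r ^ suc n) (riseFactorial (suc r) n) ⟨
      fromℕ R (suc n ! ℕ.* r ^ suc n ℕ.* riseFactorial (suc r) n)
        ≡⟨ ≡.cong (fromℕ R) (riseFactorial-suc r n) ⟨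
      fromℕ R (riseFactorial r (suc n)) ∎

theorem17 : ∀ {c ℓ : Level} (R : CommutativeRing c ℓ) (r : ℕ) → 1 ≤ r → (n : ℕ) → (x : CommutativeRing.Carrier R) →
    CommutativeRing._≈_ R (det R (suc n) (hankel R r n x)) (fromℕ R (hankelRHS r n))
theorem17 R r _ n x = begin
  det R (suc n) (hankel R r n x)                             ≈⟨ det≈detℕ R (suc n) _ (λ i j → derangePoly R r (i ℕ.+ j) x) (λ _ _ → refl) ⟩
  detℕ R (suc n) (λ i j → derangePoly R r (i ℕ.+ j) x)       ≈⟨ detℕ-cong R (suc n) (λ {i} {j} _ _ → derangePoly≈E R x r (i ℕ.+ j)) ⟩
  detℕ R (suc n) (λ i j → E R x r 0 (i ℕ.+ j))               ≈⟨ detℕ-hankel≈orderMatrix R x r n ⟩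
  detℕ R (suc n) (orderMatrix R x r)                         ≈⟨ detℕ-orderMatrix R x r n ⟩
  fromℕ R (riseFactorial r n)                                ≡⟨ ≡.cong (fromℕ R) (hankelRHS≡riseFactorial r n) ⟨
  fromℕ R (hankelRHS r n)                                    ∎
  where
  open CommutativeRing R using (setoid; refl)
  open import Relation.Binary.Reasoning.Setoid setoid
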